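{- Let $T$ be a hemi-Nelson algebra. Then every h-implicative filter of $T$ is an open implicative filter of $T$.
   Context: A Kleene algebra is a bounded distributive lattice $\langle T,\wedge,\vee,0,1\rangle$ with a unary operation $\sim$ such that $\sim\sim x=x$, $\sim(x\wedge y)=\sim x\vee\sim y$ and $(x\wedge\sim x)\wedge(y\vee\sim y)=x\wedge\sim x$. A hemi-Nelson algebra is an algebra $\langle T,\wedge,\vee,\rightarrow,\sim,0,1\rangle$ of type $(2,2,2,1,0,0)$ such that $\langle T,\wedge,\vee,\sim,0,1\rangle$ is a Kleene algebra and for all $x,y,z\in T$: (hN1) $x\rightarrow x=1$; (hN2) $x\wedge(x\rightarrow y)\le x\wedge(\sim x\vee y)$; (hN3) $\sim(x\rightarrow y)\rightarrow(x\wedge\sim y)=1$; (hN4) $(x\wedge\sim y)\rightarrow\sim(x\rightarrow y)=1$; (hN5) $(x\wedge y\wedge(x\rightarrow y))\rightarrow(x\wedge(x\rightarrow y))=1$; (hN6) $(x\wedge(x\rightarrow y))\rightarrow(x\wedge y\wedge(x\rightarrow y))=1$; (hN7) if $x\rightarrow y=1$, $y\rightarrow x=1$, $y\rightarrow z=1$ and $z\rightarrow y=1$ then $x\rightarrow z=1$ and $z\rightarrow x=1$; (hN8) if $x\rightarrow y=1$ and $y\rightarrow x=1$ then $(x\wedge z)\rightarrow(y\wedge z)=1$; (hN9) if $x\rightarrow y=1$ and $y\rightarrow x=1$ then $(x\vee z)\rightarrow(y\vee z)=1$; (hN10) if $x\rightarrow y=1$ and $y\rightarrow x=1$ then $(x\rightarrow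 z)\rightarrow(y\rightarrow z)=1$ and $(z\rightarrow x)\rightarrow(z\rightarrow y)=1$. A subset $F\subseteq T$ is an implicative filter if $1\in F$ and for all $x,y\in T$, if $x\in F$ and $x\rightarrow y\in F$ then $y\in F$. An implicative filter $F$ is open if $1\rightarrow x\in F$ whenever $x\in F$. An implicative filter $F$ is an h-implicative filter if for all $x,y\in T$ and $f\in F$: (F1) $(x\rightarrow y)\rightarrow((x\wedge f)\rightarrow(y\wedge f))\in F$; (F2) $((x\wedge f)\rightarrow(y\wedge f))\rightarrow(x\rightarrow y)\in F$; (F3) $\sim(x\rightarrow y)\rightarrow\sim((x\wedge f)\rightarrow(y\wedge f))\in F$; (F4) $\sim((x\wedge f)\rightarrow(y\wedge f))\rightarrow\sim(x\rightarrow y)\in F$. -}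

module Defs where

open import Level using (Level; _⊔_; suc)
open import Relation.Binary.PropositionalEquality using (_≡_)
open import Algebra.Lattice.Structures using (IsDistributiveLattice)
open import Data.Product using (_×_)

record HemiNelson (a : Level) : Set (suc a) where
  infixr 6 _∨_
  infixr 7 _∧_
  infixr 5 _⇒_
  field
    Carrier : Set a
    _∧_ _∨_ _⇒_ : Carrier → Carrier → Carrier
    ∼_ : Carrier → Carrier
    𝟘 𝟙 : Carrier
    isDistributiveLattice : IsDistributiveLattice _≡_ _∨_ _∧_
    ∧-𝟘 : ∀ x → x ∧ 𝟘 ≡ 𝟘
    ∨-𝟙 : ∀ x → x ∨ 𝟙 ≡ 𝟙
    ∼∼ : ∀ x → ∼ (∼ x) ≡ x
    ∼-∧ : ∀ x y → ∼ (x ∧ y) ≡ (∼ x) ∨ (∼ y)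
    kleene : ∀ x y → (x ∧ ∼ x) ∧ (y ∨ ∼ y) ≡ x ∧ ∼ x

  _≤_ : Carrier → Carrier → Set a
  x ≤ y = x ∧ y ≡ x

  field
    hN1 : ∀ x → x ⇒ x ≡ 𝟙
    hN2 : ∀ x y → (x ∧ (x ⇒ y)) ≤ (x ∧ ((∼ x) ∨ y))
    hN3 : ∀ x y → (∼ (x ⇒ y)) ⇒ (x ∧ ∼ y) ≡ 𝟙
    hN4 : ∀ x y → (x ∧ ∼ y) ⇒ (∼ (x ⇒ y)) ≡ 𝟙
    hN5 : ∀ x y → (x ∧ y ∧ (x ⇒ y)) ⇒ (x ∧ (x ⇒ y)) ≡ 𝟙
    hN6 : ∀ x y → (x ∧ (x ⇒ y)) ⇒ (x ∧ y ∧ (x ⇒ y)) ≡ 𝟙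
    hN7 : ∀ x y z → x ⇒ y ≡ 𝟙 → y ⇒ x ≡ 𝟙 → y ⇒ z ≡ 𝟙 → z ⇒ y ≡ 𝟙 →
          (x ⇒ z ≡ 𝟙) × (z ⇒ x ≡ 𝟙)
    hN8 : ∀ x y z → x ⇒ y ≡ 𝟙 → y ⇒ x ≡ 𝟙 → (x ∧ z) ⇒ (y ∧ z) ≡ 𝟙
    hN9 : ∀ x y z → x ⇒ y ≡ 𝟙 → y ⇒ x ≡ 𝟙 → (x ∨ z) ⇒ (y ∨ z) ≡ 𝟙
    hN10 : ∀ x y z → x ⇒ y ≡ 𝟙 → y ⇒ x ≡ 𝟙 →
           ((x ⇒ z) ⇒ (y ⇒ z) ≡ 𝟙) × ((z ⇒ x) ⇒ (z ⇒ y) ≡ 𝟙)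

module _ {a : Level} (T : HemiNelson a) where
  open HemiNelson T

  record IsImplicativeFilter {ℓ : Level} (F : Carrier → Set ℓ) : Set (a ⊔ ℓ) where
    field
      contains-𝟙 : F 𝟙
      mp : ∀ x y → F x → F (x ⇒ y) → F y

  record IsOpenImplicativeFilter {ℓ : Level} (F : Carrier → Set ℓ) : Set (a ⊔ ℓ) where
    field
      isImplicativeFilter : IsImplicativeFilter F
      open-𝟙⇒ : ∀ x → F x → F (𝟙 ⇒ x)

  record IsHImplicativeFilter {ℓ : Level} (F : Carrier → Set ℓ) : Set (a ⊔ ℓ) where
    field
      isImplicativeFilter : IsImplicativeFilter F
      F1 : ∀ x y f → F f → F ((x ⇒ y) ⇒ ((x ∧ f) ⇒ (y ∧ f)))
      F2 : ∀ x y f → F f → F (((x ∧ f) ⇒ (y ∧ f)) ⇒ (x ⇒ y))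
      F3 : ∀ x y f → F f → F ((∼ (x ⇒ y)) ⇒ (∼ ((x ∧ f) ⇒ (y ∧ f))))
      F4 : ∀ x y f → F f → F ((∼ ((x ∧ f) ⇒ (y ∧ f))) ⇒ (∼ (x ⇒ y)))

{-# OPTIONS --safe #-}
module Submission where

open import Defs
open import Level using (Level)
open import Relation.Binary.PropositionalEquality using (_≡_; trans; cong; cong₂; subst; module ≡-Reasoning)
open import Algebra.Lattice.Bundles using (Lattice)
import Algebra.Lattice.Properties.Lattice as LatticeProperties
open import Algebra.Lattice.Structures using (IsDistributiveLattice)

-- For x ∈ F, axiom F2 at (𝟙, x, x) puts ((𝟙 ∧ x) ⇒ (x ∧ x)) ⇒ (𝟙 ⇒ x) in F. Its antecedent
-- is x ⇒ x = 𝟙, so 𝟙 ⇒ (𝟙 ⇒ x) ∈ F, and modus ponens with 𝟙 ∈ F gives 𝟙 ⇒ x ∈ F.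

module HemiNelsonProperties {a : Level} (T : HemiNelson a) where
  open HemiNelson T
  open IsDistributiveLattice isDistributiveLattice using (isLattice; ∧-comm; ∧-absorbs-∨)

  lattice : Lattice a a
  lattice = record { isLattice = isLattice }

  open LatticeProperties lattice public using (∧-idem)

  ∧-identityʳ : ∀ x → x ∧ 𝟙 ≡ x
  ∧-identityʳ x = subst (λ t → x ∧ t ≡ x) (∨-𝟙 x) (∧-absorbs-∨ x 𝟙)

  ∧-identityˡ : ∀ x → 𝟙 ∧ x ≡ x
  ∧-identityˡ x = trans (∧-comm 𝟙 x) (∧-identityʳ x)

  module _ {ℓ : Level} {F : Carrier → Set ℓ} (IF : IsImplicativeFilter T F) where
    open IsImplicativeFilter IF

    𝟙⇒-elim : ∀ {y} → F (𝟙 ⇒ y) → F y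
    𝟙⇒-elim {y} = mp 𝟙 y contains-𝟙

  module _ {ℓ : Level} {F : Carrier → Set ℓ} (HF : IsHImplicativeFilter T F) where
    open IsHImplicativeFilter HF

    𝟙⇒𝟙⇒-intro : ∀ {x} → F x → F (𝟙 ⇒ (𝟙 ⇒ x))
    𝟙⇒𝟙⇒-intro {x} x∈F = subst (λ t → F (t ⇒ (𝟙 ⇒ x))) antecedent≡𝟙 (F2 𝟙 x x x∈F)
      where
      open ≡-Reasoning
      antecedent≡𝟙 : (𝟙 ∧ x) ⇒ (x ∧ x) ≡ 𝟙
      antecedent≡𝟙 = begin
        (𝟙 ∧ x) ⇒ (x ∧ x)  ≡⟨ cong₂ _⇒_ (∧-identityˡ x) (∧-idem x) ⟩
        x ⇒ x              ≡⟨ hN1 x ⟩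
        𝟙                  ∎

proposition28 : {a ℓ : Level} (T : HemiNelson a) (F : HemiNelson.Carrier T → Set ℓ) →
                IsHImplicativeFilter T F → IsOpenImplicativeFilter T F
proposition28 T F HF = record
  { isImplicativeFilter = isImplicativeFilter
  ; open-𝟙⇒             = λ x x∈F → 𝟙⇒-elim isImplicativeFilter (𝟙⇒𝟙⇒-intro HF x∈F)
  }
  where
  open HemiNelsonProperties T
  open IsHImplicativeFilter HF using (isImplicativeFilter)
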